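{- Let $h\geq 3$ and $k\geq 3h+4$ be positive integers, and let $A=[0,k+2]\setminus\{x,x+1,x+2\}$ with $x\in[1,k-1]$. (i) If $x\in[1,h-1]$, then $|h^{\wedge}A| = hk-h^2+3x+1$. (ii) If $x\in[k-h+1,k-1]$, then $|h^{\wedge}A| = (h+3)k-h^2-3x+1$. (iii) If $x\in\{h,k-h\}$, then $|h^{\wedge}A| = hk-h^2+3h-2$. (iv) If $x\in\{h+1,k-h-1\}$, then $|h^{\wedge}A| = 3k$ when $h=3$, and $|h^{\wedge}A| = hk-h^2+3h+1$ when $h\geq 4$. (v) If $x\in[h+2,k-h-2]$, then $|h^{\wedge}A| = hk-h^2+3h+1$.
   Context: For a finite set $A$ of integers and a positive integer $h\le |A|$, the restricted $h$-fold sumset $h^{\wedge}A$ is the set of all sums of $h$ distinct elements of $A$. For integers $\alpha\le\beta$, $[\alpha,\beta]=\{x\in\mathbb{Z}:\alpha\le x\le\beta\}$. -}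

module Defs where

open import Data.Nat using (ℕ)
open import Data.Integer using (ℤ; +_; _≤_; _+_)
open import Data.List using (List; length; foldr)
open import Data.List.Relation.Unary.All using (All)
open import Data.List.Relation.Unary.Unique.Propositional using (Unique)
open import Data.List.Membership.Propositional using (_∈_)
open import Data.Product using (Σ; _×_)
open import Relation.Binary.PropositionalEquality using (_≡_)
open import Relation.Nullary using (¬_)
open import Function.Bundles using (_⇔_)

Subset : Set₁
Subset = ℤ → Set

Icc : ℤ → ℤ → Subset
Icc α β z = (α ≤ z) × (z ≤ β)

removeBlock : (k x : ℕ) → Subset
removeBlock k x z = Icc (+ 0) (+ (k Data.Nat.+ 2)) z × ¬ Icc (+ x) (+ (x Data.Nat.+ 2)) z

sumℤ : List ℤ → ℤ
sumℤ = foldr _+_ (+ 0)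

restrictedSumset : ℕ → Subset → Subset
restrictedSumset h A m =
  Σ (List ℤ) λ S → Unique S × All A S × length S ≡ h × sumℤ S ≡ m

-- (Cardinality is compared as an integer so that the paper's integer
-- expressions can be used directly.)
-- A set P has (finite) cardinality n: it is enumerated by a duplicate-free list of length n.
HasCard : Subset → ℤ → Set
HasCard P n = Σ (List ℤ) λ L → Unique L × (∀ z → (z ∈ L) ⇔ P z) × + length L ≡ n

-- Write A = L ∪ U with L = [0, x − 1] and U = [x + 3, k + 2]. Sums of v distinct elements of an
-- interval fill an interval, so the sums of h distinct elements of A with v of them in L fill an
-- interval [low v, high v]. When one summand moves from L to U (from v + 1 to v summands in L and
-- from u to u + 1 in U), the new interval still meets the old one provided
-- u + 3 ≤ v (x − v − 1) + u (|U| − u). For u ≥ 1 this holds as soon as |U| ≥ h + 2, and for u = 0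
-- it reads 3 ≤ (h − 1)(x − h). So h^A fills the interval between its obvious bounds, except for
-- the gaps left by that first move when x = h (the sums h(h − 1)/2 + 1, …, h(h − 1)/2 + 3) or
-- when h = 3 and x = 4 (the sum 7); the largest summand shows that these gaps are real. The bounds
-- come from comparing a decreasing list of summands with the increasing enumerations of ℕ and of
-- A. The reflection a ↦ k + 2 − a maps A for x onto A for k − x, which settles the remaining cases.

module Submission where

open import Defs
open import Data.Nat using (ℕ; _≤_; _<_; _+_; _*_; _∸_)
open import Data.Integer using (ℤ; +_) renaming (_+_ to _+ℤ_; _-_ to _-ℤ_; _*_ to _*ℤ_)
open import Data.Product using (_×_)
open import Data.Sum using (_⊎_)
open import Relation.Binary.PropositionalEquality using (_≡_)

open import Data.Nat using (zero; suc; _>_; z≤n; s≤s; z<s; _≤?_; _<?_)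
open import Data.Nat.Properties
open import Data.Nat.Tactic.RingSolver using (solve-∀)
open import Data.Nat.ListAction using (sum)
open import Data.Nat.ListAction.Properties using (sum-↭; sum-++)
open import Algebra.Properties.CommutativeSemigroup +-commutativeSemigroup using () renaming (interchange to +-interchange)
open import Data.Integer using (+≤+)
import Data.Integer.Properties as ℤP
import Data.Integer.Tactic.RingSolver as ZS
open import Data.Empty using (⊥; ⊥-elim)
open import Data.Product using (∃; _,_; proj₁; proj₂)
open import Data.Sum as Sum using (inj₁; inj₂; [_,_]′)
open import Data.List using (List; []; _∷_; _++_; length; map; applyUpTo)
open import Data.List.Properties using (map-id; length-++; length-map; length-applyUpTo)
open import Data.List.Membership.Propositional using (_∈_)
open import Data.List.Membership.Propositional.Properties using (∈-applyUpTo⁺; ∈-applyUpTo⁻; ∈-map⁺; ∈-map⁻; ∈-++⁺ˡ; ∈-++⁺ʳ; ∈-++⁻)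
open import Data.List.Relation.Unary.All as All using (All; []; _∷_)
import Data.List.Relation.Unary.All.Properties as AllP
open import Data.List.Relation.Unary.AllPairs as AllPairs using (AllPairs; []; _∷_)
import Data.List.Relation.Unary.AllPairs.Properties as AllPairsP
open import Data.List.Relation.Unary.Linked.Properties using (Linked⇒AllPairs)
open import Data.List.Relation.Unary.Unique.Propositional using (Unique)
import Data.List.Relation.Unary.Unique.Propositional.Properties as Unique
open import Data.List.Relation.Binary.Permutation.Propositional using (↭-sym; ↭⇒↭ₛ)
open import Data.List.Relation.Binary.Permutation.Propositional.Properties using (All-resp-↭; ↭-length)
import Data.List.Relation.Binary.Permutation.Setoid.Properties as Permutationₛ
open import Relation.Binary.Properties.DecTotalOrder ≤-decTotalOrder using (≥-decTotalOrder)
open import Data.List.Sort ≥-decTotalOrder using (sort; sort-↭; sort-↗)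
open import Function using (_∘_; _⇔_; mk⇔; Equivalence)
open import Function.Properties.Equivalence using () renaming (trans to ⇔-trans; sym to ⇔-sym)
open import Relation.Binary.Core using (_Preserves_⟶_)
open import Relation.Nullary using (yes; no)
open import Relation.Binary.PropositionalEquality using (refl; sym; trans; cong; cong₂; subst; subst₂; setoid; ≢-sym; module ≡-Reasoning)

-- Sums of distinct naturals

∑< : ℕ → (ℕ → ℕ) → ℕ
∑< zero    g = 0
∑< (suc n) g = ∑< n g + g n

-- tri n = 0 + 1 + ⋯ + (n − 1), the least sum of n distinct naturals.
tri : ℕ → ℕ
tri n = ∑< n (λ i → i)

tri-double : ∀ n → tri n + tri n + n ≡ n * n
tri-double zero    = refl
tri-double (suc n) = begin
  (tri n + n) + (tri n + n) + suc n  ≡⟨ regroup (tri n) n ⟩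
  (tri n + tri n + n) + (2 * n + 1)  ≡⟨ cong (_+ (2 * n + 1)) (tri-double n) ⟩
  n * n + (2 * n + 1)                ≡⟨ square n ⟩
  suc n * suc n                      ∎
  where
  open ≡-Reasoning
  regroup : ∀ t n → (t + n) + (t + n) + suc n ≡ (t + t + n) + (2 * n + 1)
  regroup = solve-∀
  square : ∀ n → n * n + (2 * n + 1) ≡ suc n * suc n
  square = solve-∀

tri-+ : ∀ m n → tri (m + n) ≡ tri m + tri n + m * n
tri-+ m zero    = trans (cong tri (+-identityʳ m)) (pad (tri m) m)
  where
  pad : ∀ t m → t ≡ t + 0 + m * 0
  pad = solve-∀
tri-+ m (suc n) = begin
  tri (m + suc n)                    ≡⟨ cong tri (+-suc m n) ⟩
  tri (m + n) + (m + n)              ≡⟨ cong (_+ (m + n)) (tri-+ m n) ⟩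
  tri m + tri n + m * n + (m + n)    ≡⟨ regroup (tri m) (tri n) m n ⟩
  tri m + (tri n + n) + m * suc n    ∎
  where
  open ≡-Reasoning
  regroup : ∀ s t m n → s + t + m * n + (m + n) ≡ s + (t + n) + m * suc n
  regroup = solve-∀

Decreasing : List ℕ → Set
Decreasing = AllPairs _>_

Decreasing⇒Unique : ∀ {S} → Decreasing S → Unique S
Decreasing⇒Unique = AllPairs.map >⇒≢

length≤ : ∀ {S b} → Decreasing S → All (_< b) S → length S ≤ b
length≤ []            []        = z≤n
length≤ (a>S ∷ S-dec) (a<b ∷ _) = ≤-trans (s≤s (length≤ S-dec a>S)) a<b

∑<≤sum-map : ∀ {g} → g Preserves _≤_ ⟶ _≤_ → ∀ {R} → Decreasing R → ∑< (length R) g ≤ sum (map g R)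
∑<≤sum-map         mono         []            = z≤n
∑<≤sum-map {g} mono {a ∷ R} (a>R ∷ R-dec) = begin
  ∑< (length R) g + g (length R)  ≤⟨ +-mono-≤ (∑<≤sum-map mono R-dec) (mono (length≤ R-dec a>R)) ⟩
  sum (map g R) + g a             ≡⟨ +-comm (sum (map g R)) (g a) ⟩
  g a + sum (map g R)             ∎
  where open ≤-Reasoning

tri≤sum : ∀ {S} → Decreasing S → tri (length S) ≤ sum S
tri≤sum {S} S-dec = subst (tri (length S) ≤_) (cong sum (map-id S)) (∑<≤sum-map (λ i≤j → i≤j) S-dec)

sum+tri≤ : ∀ {S b} → Decreasing S → All (_< b) S → sum S + tri (length S) + length S ≤ length S * b
sum+tri≤             []            []        = z≤n
sum+tri≤ {a ∷ S} {b} (a>S ∷ S-dec) (a<b ∷ _) = begin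
  a + sum S + (tri n + n) + suc n  ≡⟨ regroup a (sum S) (tri n) n ⟩
  suc a + n + (sum S + tri n + n)  ≤⟨ +-monoʳ-≤ (suc a + n) (sum+tri≤ S-dec a>S) ⟩
  suc a + n + n * a                ≡⟨ factor a n ⟩
  suc n * suc a                    ≤⟨ *-monoʳ-≤ (suc n) a<b ⟩
  suc n * b                        ∎
  where
  open ≤-Reasoning
  n = length S
  regroup : ∀ a s t n → a + s + (t + n) + suc n ≡ suc a + n + (s + t + n)
  regroup = solve-∀
  factor : ∀ a n → suc a + n + n * a ≡ suc n * suc a
  factor = solve-∀

All⇒∃-map : ∀ {A B : Set} {f : A → B} {ys} → All (λ y → ∃ λ x → f x ≡ y) ys → ∃ λ xs → map f xs ≡ ys
All⇒∃-map []                = [] , refl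
All⇒∃-map ((x , refl) ∷ ps) with All⇒∃-map ps
... | xs , refl = x ∷ xs , refl

monotone⇒reflects-< : ∀ {g} → g Preserves _≤_ ⟶ _≤_ → ∀ {i j} → g i < g j → i < j
monotone⇒reflects-< mono gi<gj = ≰⇒> (λ j≤i → <⇒≱ gi<gj (mono j≤i))

Unique-map⁺-on : ∀ {A B : Set} {P : A → Set} {f : A → B} → (∀ {a b} → P a → P b → f a ≡ f b → a ≡ b) →
                 ∀ {xs} → All P xs → Unique xs → Unique (map f xs)
Unique-map⁺-on inj []        []         = []
Unique-map⁺-on inj (pa ∷ ps) (a∉xs ∷ u) =
  AllP.map⁺ (All.zipWith (λ (pb , a≢b) fa≡fb → a≢b (inj pa pb fa≡fb)) (ps , a∉xs)) ∷ Unique-map⁺-on inj ps u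

∸-injectiveOn : ∀ {M a b} → a ≤ M → b ≤ M → M ∸ a ≡ M ∸ b → a ≡ b
∸-injectiveOn {M} a≤M b≤M M∸a≡M∸b = trans (sym (m∸[m∸n]≡n a≤M)) (trans (cong (M ∸_) M∸a≡M∸b) (m∸[m∸n]≡n b≤M))

sum-map-∸ : ∀ M S → All (_≤ M) S → sum (map (M ∸_) S) + sum S ≡ length S * M
sum-map-∸ M []      []          = refl
sum-map-∸ M (a ∷ S) (a≤M ∷ S≤M) = begin
  (M ∸ a) + sum (map (M ∸_) S) + (a + sum S)  ≡⟨ +-interchange (M ∸ a) _ a _ ⟩
  (M ∸ a + a) + (sum (map (M ∸_) S) + sum S)  ≡⟨ cong₂ _+_ (m∸n+n≡m a≤M) (sum-map-∸ M S S≤M) ⟩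
  M + length S * M                            ∎
  where open ≡-Reasoning

Sums : ℕ → (ℕ → Set) → ℕ → Set
Sums h B m = ∃ λ S → Decreasing S × All B S × length S ≡ h × sum S ≡ m

sums-fromUnique : ∀ {B S} → Unique S → All B S → Sums (length S) B (sum S)
sums-fromUnique {S = S} S-unique S⊆B =
  sort S , sort-decreasing , All-resp-↭ (↭-sym (sort-↭ S)) S⊆B , ↭-length (sort-↭ S) , sum-↭ (sort-↭ S)
  where
  sort-unique : Unique (sort S)
  sort-unique = Permutationₛ.Unique-resp-↭ (setoid ℕ) (↭⇒↭ₛ (↭-sym (sort-↭ S))) S-unique
  sort-decreasing : Decreasing (sort S)
  sort-decreasing = AllPairs.zipWith (λ (b≤a , a≢b) → ≤∧≢⇒< b≤a (≢-sym a≢b))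
    (Linked⇒AllPairs (λ b≤a c≤b → ≤-trans c≤b b≤a) (sort-↗ S) , sort-unique)

sums-mono : ∀ {h B C m} → (∀ {a} → B a → C a) → Sums h B m → Sums h C m
sums-mono B⊆C (S , S-dec , S⊆B , len , sm) = S , S-dec , All.map B⊆C S⊆B , len , sm

sums-∷ : ∀ {h B m t} → B t → Sums h (λ s → B s × s < t) m → Sums (suc h) B (t + m)
sums-∷ Bt (S , S-dec , S⊆ , refl , refl) = _ ∷ S , All.map proj₂ S⊆ ∷ S-dec , Bt ∷ All.map proj₁ S⊆ , refl , refl

sums-++ : ∀ {B C u v m n} → (∀ {b c} → B b → C c → c < b) →
          Sums u B m → Sums v C n → Sums (u + v) (λ a → B a ⊎ C a) (m + n)
sums-++ C<B (S , S-dec , S⊆B , refl , refl) (T , T-dec , T⊆C , refl , refl) =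
  S ++ T ,
  AllPairsP.++⁺ S-dec T-dec (All.map (λ Bb → All.map (C<B Bb) T⊆C) S⊆B) ,
  AllP.++⁺ (All.map inj₁ S⊆B) (All.map inj₂ T⊆C) ,
  length-++ S , sum-++ S T

sums-≤ : ∀ {h B b m} → (∀ {a} → B a → a < b) → Sums h B m → m + tri h + h ≤ h * b
sums-≤ B<b (S , S-dec , S⊆B , refl , refl) = sum+tri≤ S-dec (All.map B<b S⊆B)

-- Intervals of sums

Covers : (ℕ → Set) → ℕ → ℕ → Set
Covers P a b = ∀ m → a ≤ m → m ≤ b → P m

covers-offsets : ∀ {P a w} → (∀ {r} → r ≤ w → P (a + r)) → Covers P a (a + w)
covers-offsets {P} {a} P[a+_] m a≤m m≤a+w = subst P (m+[n∸m]≡n a≤m) (P[a+_] (m≤n+o⇒m∸n≤o m a m≤a+w))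

covers-∪ : ∀ {P a b c d} → Covers P a b → Covers P c d → c ≤ suc b → Covers P a d
covers-∪ {b = b} P⊇[a,b] P⊇[c,d] c≤1+b m a≤m m≤d with m ≤? b
... | yes m≤b = P⊇[a,b] m a≤m m≤b
... | no  m≰b = P⊇[c,d] m (≤-trans c≤1+b (≰⇒> m≰b)) m≤d

covers-+ : ∀ {P Q R : ℕ → Set} {a b c d} → (∀ {m n} → P m → Q n → R (m + n)) →
           a ≤ b → c ≤ d → Covers P a b → Covers Q c d → Covers R (a + c) (b + d)
covers-+ {R = R} {a} {b} {c} {d} _⊕_ a≤b c≤d P⊇ Q⊇ m a+c≤m m≤b+d with m ≤? b + c
... | yes m≤b+c = subst R (m∸n+n≡m c≤m)
        (P⊇ (m ∸ c) (m+n≤o⇒m≤o∸n a a+c≤m) (m≤n+o⇒m∸n≤o m c (≤-trans m≤b+c (≤-reflexive (+-comm b c))))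
         ⊕ Q⊇ c ≤-refl c≤d)
  where c≤m = ≤-trans (m≤n+m c a) a+c≤m
... | no  m≰b+c = subst R (m+[n∸m]≡n b≤m)
        (P⊇ b a≤b ≤-refl ⊕ Q⊇ (m ∸ b) (m+n≤o⇒m≤o∸n c c+b≤m) (m≤n+o⇒m∸n≤o m b m≤b+d))
  where
  c+b≤m = ≤-trans (≤-reflexive (+-comm c b)) (<⇒≤ (≰⇒> m≰b+c))
  b≤m   = ≤-trans (m≤n+m b c) c+b≤m

Ico : ℕ → ℕ → ℕ → Set
Ico a b s = a ≤ s × s < b

sums-Ico-top : ∀ {n a e d r′ r} → d ≤ e → d + r′ ≡ r →
               Sums n (Ico a (a + n + d)) (a * n + tri n + r′) →
               Sums (suc n) (Ico a (a + suc n + e)) (a * suc n + tri (suc n) + r)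
sums-Ico-top {n} {a} {e} {d} {r′} d≤e refl sums =
  subst (Sums (suc n) _) (regroup a n d (tri n) r′) (sums-∷ (top-lower , top-upper) (sums-mono narrow sums))
  where
  widen : a + n + d ≤ a + suc n + e
  widen = +-mono-≤ (+-monoʳ-≤ a (n≤1+n n)) d≤e
  narrow : ∀ {s} → Ico a (a + n + d) s → Ico a (a + suc n + e) s × s < a + n + d
  narrow (a≤s , s<top) = (a≤s , <-≤-trans s<top widen) , s<top
  top-lower : a ≤ a + n + d
  top-lower = ≤-trans (m≤m+n a n) (m≤m+n (a + n) d)
  top-upper : a + n + d < a + suc n + e
  top-upper = ≤-trans (s≤s (+-monoʳ-≤ (a + n) d≤e)) (≤-reflexive (cong (_+ e) (sym (+-suc a n))))
  regroup : ∀ a n d t r′ → a + n + d + (a * n + t + r′) ≡ a * suc n + (t + n) + (d + r′)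
  regroup = solve-∀

-- The largest summand, a + n + min(r, e), takes as much of the excess r as it can.
interval-sums : ∀ n a e {r} → r ≤ n * e → Sums n (Ico a (a + n + e)) (a * n + tri n + r)
interval-sums zero    a e {zero} _ = [] , [] , [] , refl , empty-sum a
  where
  empty-sum : ∀ a → 0 ≡ a * 0 + 0 + 0
  empty-sum = solve-∀
interval-sums (suc n) a e {r} r≤ with ≤-total r e
... | inj₁ r≤e = sums-Ico-top r≤e (+-identityʳ r) (interval-sums n a r {0} z≤n)
... | inj₂ e≤r = sums-Ico-top ≤-refl (m+[n∸m]≡n e≤r) (interval-sums n a e (m≤n+o⇒m∸n≤o r e r≤))

-- Finite cardinalities

IsEnumeration : {A : Set} → List A → (A → Set) → Set
IsEnumeration L P = Unique L × (∀ z → z ∈ L ⇔ P z)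

enum-resp : ∀ {A : Set} {L : List A} {P Q : A → Set} → IsEnumeration L P → (∀ z → P z ⇔ Q z) → IsEnumeration L Q
enum-resp (u , L⇔P) P⇔Q = u , λ z → ⇔-trans (L⇔P z) (P⇔Q z)

enum-map : ∀ {A B : Set} {L : List A} {P : A → Set} {f : A → B} → (∀ {a b} → P a → P b → f a ≡ f b → a ≡ b) →
           IsEnumeration L P → IsEnumeration (map f L) (λ z → ∃ λ a → P a × z ≡ f a)
enum-map {L = L} {f = f} inj (u , L⇔P) =
  Unique-map⁺-on inj (All.tabulate (λ {a} a∈L → Equivalence.to (L⇔P a) a∈L)) u ,
  λ z → mk⇔ to from
  where
  to : ∀ {z} → z ∈ map f L → ∃ λ a → _ × z ≡ f a
  to z∈ with ∈-map⁻ f z∈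
  ... | a , a∈L , z≡fa = a , Equivalence.to (L⇔P a) a∈L , z≡fa
  from : ∀ {z} → (∃ λ a → _ × z ≡ f a) → z ∈ map f L
  from (a , Pa , refl) = ∈-map⁺ f (Equivalence.from (L⇔P a) Pa)

HasCardℕ : (ℕ → Set) → ℤ → Set
HasCardℕ P n = ∃ λ L → IsEnumeration L P × + length L ≡ n

hasCardℕ-resp : ∀ {P Q n} → HasCardℕ P n → (∀ z → P z ⇔ Q z) → HasCardℕ Q n
hasCardℕ-resp (L , L-enum , |L|≡n) P⇔Q = L , enum-resp L-enum P⇔Q , |L|≡n

hasCardℕ-Icc : ∀ a b → a ≤ suc b → HasCardℕ (λ m → a ≤ m × m ≤ b) (+ (suc b ∸ a))
hasCardℕ-Icc a b a≤1+b =
  L ,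
  (Unique.applyUpTo⁺₁ (λ i → a + i) n (λ i<j _ a+i≡a+j → <⇒≢ i<j (+-cancelˡ-≡ a _ _ a+i≡a+j)) ,
   λ m → mk⇔ to (from m)) ,
  cong +_ (length-applyUpTo (λ i → a + i) n)
  where
  n = suc b ∸ a
  L = applyUpTo (λ i → a + i) n
  to : ∀ {m} → m ∈ L → a ≤ m × m ≤ b
  to m∈L with ∈-applyUpTo⁻ (λ i → a + i) m∈L
  ... | i , i<n , refl = m≤m+n a i , ≤-pred (≤-trans (+-monoʳ-< a i<n) (≤-reflexive (m+[n∸m]≡n a≤1+b)))
  from : ∀ m → a ≤ m × m ≤ b → m ∈ L
  from m (a≤m , m≤b) = subst (_∈ L) (m+[n∸m]≡n a≤m) (∈-applyUpTo⁺ (λ i → a + i) (∸-monoˡ-< (s≤s m≤b) a≤m))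

hasCardℕ-⊎ : ∀ {P Q a b} → HasCardℕ P a → HasCardℕ Q b → (∀ {z} → P z → Q z → ⊥) →
             HasCardℕ (λ z → P z ⊎ Q z) (a +ℤ b)
hasCardℕ-⊎ (L , (u , L⇔P) , refl) (L′ , (u′ , L′⇔Q) , refl) P∩Q=∅ =
  L ++ L′ ,
  (Unique.++⁺ u u′ (λ (z∈L , z∈L′) → P∩Q=∅ (Equivalence.to (L⇔P _) z∈L) (Equivalence.to (L′⇔Q _) z∈L′)) ,
   λ z → mk⇔ (Sum.map (Equivalence.to (L⇔P z)) (Equivalence.to (L′⇔Q z)) ∘ ∈-++⁻ L)
             ([ ∈-++⁺ˡ , ∈-++⁺ʳ L ]′ ∘ Sum.map (Equivalence.from (L⇔P z)) (Equivalence.from (L′⇔Q z)))) ,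
  cong +_ (length-++ L)

-- The set A = [0, k + 2] ∖ [x, x + 2]

Block : ℕ → ℕ → ℕ → Set
Block k x a = a ≤ k + 2 × (a < x ⊎ x + 2 < a)

Block⇒< : ∀ {k x a} → Block k x a → a < k + 3
Block⇒< (a≤k+2 , _) = ≤-trans (s≤s a≤k+2) (≤-reflexive (sym (+-suc _ 2)))

-- jump x enumerates ℕ ∖ [x, x + 2] in increasing order.
jump : ℕ → ℕ → ℕ
jump x i with i <? x
... | yes _ = i
... | no  _ = 3 + i

jump-mono : ∀ x → jump x Preserves _≤_ ⟶ _≤_
jump-mono x {i} {j} i≤j with i <? x | j <? x
... | yes _   | yes _   = i≤j
... | yes _   | no  _   = ≤-trans i≤j (m≤n+m j 3)
... | no  i≮x | yes j<x = ⊥-elim (i≮x (≤-<-trans i≤j j<x))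
... | no  _   | no  _   = +-monoʳ-≤ 3 i≤j

jump-< : ∀ {x i} → i < x → jump x i ≡ i
jump-< {x} {i} i<x with i <? x
... | yes _   = refl
... | no  i≮x = ⊥-elim (i≮x i<x)

jump-≥ : ∀ {x i} → x ≤ i → jump x i ≡ 3 + i
jump-≥ {x} {i} x≤i with i <? x
... | yes i<x = ⊥-elim (<⇒≱ i<x x≤i)
... | no  _   = refl

Block⊆jump-image : ∀ {k x a} → Block k x a → ∃ λ i → jump x i ≡ a
Block⊆jump-image (_ , inj₁ a<x)            = _ , jump-< a<x
Block⊆jump-image {x = x} {a} (_ , inj₂ x+2<a) =
  a ∸ 3 , trans (jump-≥ (m+n≤o⇒m≤o∸n x x+3≤a)) (m+[n∸m]≡n (≤-trans (m≤n+m 3 x) x+3≤a))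
  where
  x+3≤a : x + 3 ≤ a
  x+3≤a = ≤-trans (≤-reflexive (+-suc x 2)) x+2<a

∑<-jump : ∀ x n → ∑< n (jump x) ≡ tri n + 3 * (n ∸ x)
∑<-jump x zero    = cong (3 *_) (sym (0∸n≡0 x))
∑<-jump x (suc n) with n <? x
... | yes n<x = begin
  ∑< n (jump x) + n            ≡⟨ cong (_+ n) (∑<-jump x n) ⟩
  tri n + 3 * (n ∸ x) + n      ≡⟨ shuffle (tri n) (n ∸ x) n ⟩
  tri n + n + 3 * (n ∸ x)      ≡⟨ cong (λ d → tri n + n + 3 * d) n∸x≡1+n∸x ⟩
  tri n + n + 3 * (suc n ∸ x)  ∎
  where
  open ≡-Reasoning
  n∸x≡1+n∸x : n ∸ x ≡ suc n ∸ x
  n∸x≡1+n∸x = trans (m≤n⇒m∸n≡0 (<⇒≤ n<x)) (sym (m≤n⇒m∸n≡0 n<x))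
  shuffle : ∀ t d n → t + 3 * d + n ≡ t + n + 3 * d
  shuffle = solve-∀
... | no n≮x = begin
  ∑< n (jump x) + (3 + n)          ≡⟨ cong (_+ (3 + n)) (∑<-jump x n) ⟩
  tri n + 3 * (n ∸ x) + (3 + n)    ≡⟨ shuffle (tri n) (n ∸ x) n ⟩
  tri n + n + 3 * suc (n ∸ x)      ≡⟨ cong (λ d → tri n + n + 3 * d) (sym (+-∸-assoc 1 (≮⇒≥ n≮x))) ⟩
  tri n + n + 3 * (suc n ∸ x)      ∎
  where
  open ≡-Reasoning
  shuffle : ∀ t d n → t + 3 * d + (3 + n) ≡ t + n + 3 * suc d
  shuffle = solve-∀

sums-Block-≥ : ∀ {h k x m} → Sums h (Block k x) m → tri h + 3 * (h ∸ x) ≤ m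
sums-Block-≥ {x = x} (S , S-dec , S⊆B , refl , refl) with All⇒∃-map (All.map Block⊆jump-image S⊆B)
... | R , refl = begin
  tri (length (map (jump x) R)) + 3 * (length (map (jump x) R) ∸ x)
    ≡⟨ cong (λ n → tri n + 3 * (n ∸ x)) (length-map (jump x) R) ⟩
  tri (length R) + 3 * (length R ∸ x)  ≡⟨ sym (∑<-jump x (length R)) ⟩
  ∑< (length R) (jump x)               ≤⟨ ∑<≤sum-map (jump-mono x) R-dec ⟩
  sum (map (jump x) R)                 ∎
  where
  open ≤-Reasoning
  R-dec : Decreasing R
  R-dec = AllPairs.map (monotone⇒reflects-< (jump-mono x)) (AllPairsP.map⁻ S-dec)

sums-Block-gap : ∀ {h k x m} → Sums (suc h) (Block k x) m →
                 m + tri (suc h) + suc h ≤ suc h * x ⊎ x + 3 + tri h ≤ m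
sums-Block-gap (a ∷ S , a>S ∷ S-dec , (_ , inj₁ a<x) ∷ _ , refl , refl) =
  inj₁ (sum+tri≤ (a>S ∷ S-dec) (a<x ∷ All.map (λ s<a → <-trans s<a a<x) a>S))
sums-Block-gap (a ∷ S , a>S ∷ S-dec , (_ , inj₂ x+2<a) ∷ _ , refl , refl) =
  inj₂ (+-mono-≤ (≤-trans (≤-reflexive (+-suc _ 2)) x+2<a) (tri≤sum S-dec))

sums-Block-≤ : ∀ {h k x m} → Sums h (Block k x) m → m ≤ h * (k + 2)
sums-Block-≤ {h} {k} {m = m} sums = +-cancelʳ-≤ h m (h * (k + 2)) (begin
  m + h          ≤⟨ +-monoˡ-≤ h (m≤m+n m (tri h)) ⟩
  m + tri h + h  ≤⟨ sums-≤ Block⇒< sums ⟩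
  h * (k + 3)    ≡⟨ split h k ⟩
  h * (k + 2) + h  ∎)
  where
  open ≤-Reasoning
  split : ∀ h k → h * (k + 3) ≡ h * (k + 2) + h
  split = solve-∀

Block-reflect : ∀ {k x a} → x ≤ k → Block k x a → Block k (k ∸ x) (k + 2 ∸ a)
Block-reflect {k} {x} {a} x≤k (a≤k+2 , inj₁ a<x) =
  m∸n≤m (k + 2) a , inj₂ (subst (_< k + 2 ∸ a) (+-∸-comm 2 x≤k) (∸-monoʳ-< a<x (≤-trans x≤k (m≤m+n k 2))))
Block-reflect {k} {x} {a} x≤k (a≤k+2 , inj₂ x+2<a) =
  m∸n≤m (k + 2) a , inj₁ (subst (k + 2 ∸ a <_) k+2∸[x+2]≡k∸x (∸-monoʳ-< x+2<a a≤k+2))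
  where
  k+2∸[x+2]≡k∸x : k + 2 ∸ (x + 2) ≡ k ∸ x
  k+2∸[x+2]≡k∸x = trans (cong₂ _∸_ (+-comm k 2) (+-comm x 2)) ([m+n]∸[m+o]≡n∸o 2 k x)

sums-reflect : ∀ {h k x m} → x ≤ k → Sums h (Block k x) m → Sums h (Block k (k ∸ x)) (h * (k + 2) ∸ m)
sums-reflect {k = k} {x} x≤k (S , S-dec , S⊆B , refl , refl) =
  subst₂ (λ n m → Sums n (Block k (k ∸ x)) m) (length-map (k + 2 ∸_) S) sum-eq
    (sums-fromUnique (Unique-map⁺-on ∸-injectiveOn S≤ (Decreasing⇒Unique S-dec))
                     (AllP.map⁺ (All.map (Block-reflect x≤k) S⊆B)))
  where
  S≤ : All (_≤ k + 2) S
  S≤ = All.map proj₁ S⊆B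
  sum-eq : sum (map (k + 2 ∸_) S) ≡ length S * (k + 2) ∸ sum S
  sum-eq = trans (sym (m+n∸n≡m _ (sum S))) (cong (_∸ sum S) (sum-map-∸ (k + 2) S S≤))

hasCardℕ-reflect : ∀ {h k x n} → x ≤ k → HasCardℕ (Sums h (Block k (k ∸ x))) n → HasCardℕ (Sums h (Block k x)) n
hasCardℕ-reflect {h} {k} {x} x≤k (L , L-enum , |L|≡n) =
  map (M ∸_) L ,
  enum-resp (enum-map (λ Pa Pb → ∸-injectiveOn (sums-Block-≤ Pa) (sums-Block-≤ Pb)) L-enum) (λ z → mk⇔ to (from z)) ,
  trans (cong +_ (length-map (M ∸_) L)) |L|≡n
  where
  M = h * (k + 2)
  to : ∀ {z} → (∃ λ a → Sums h (Block k (k ∸ x)) a × z ≡ M ∸ a) → Sums h (Block k x) z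
  to (a , sums , refl) = subst (λ y → Sums h (Block k y) (M ∸ a)) (m∸[m∸n]≡n x≤k) (sums-reflect (m∸n≤m k x) sums)
  from : ∀ z → Sums h (Block k x) z → ∃ λ a → Sums h (Block k (k ∸ x)) a × z ≡ M ∸ a
  from z sums = M ∸ z , sums-reflect x≤k sums , sym (m∸[m∸n]≡n (sums-Block-≤ sums))

-- Restricted sumsets of integers

sumℤ-map-+ : ∀ S → sumℤ (map +_ S) ≡ + sum S
sumℤ-map-+ []      = refl
sumℤ-map-+ (a ∷ S) = cong (+ a +ℤ_) (sumℤ-map-+ S)

Block⇒removeBlock : ∀ {k x a} → Block k x a → removeBlock k x (+ a)
Block⇒removeBlock (a≤k+2 , a∉[x,x+2]) =
  (+≤+ z≤n , +≤+ a≤k+2) ,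
  λ { (+≤+ x≤a , +≤+ a≤x+2) → [ (λ a<x → <⇒≱ a<x x≤a) , (λ x+2<a → <⇒≱ x+2<a a≤x+2) ]′ a∉[x,x+2] }

removeBlock⇒Block : ∀ {k x a} → removeBlock k x (+ a) → Block k x a
removeBlock⇒Block {x = x} {a} ((_ , +≤+ a≤k+2) , a∉[x,x+2]) with a <? x | x + 2 <? a
... | yes a<x | _         = a≤k+2 , inj₁ a<x
... | no  _   | yes x+2<a = a≤k+2 , inj₂ x+2<a
... | no  a≮x | no  a≯x+2 = ⊥-elim (a∉[x,x+2] (+≤+ (≮⇒≥ a≮x) , +≤+ (≮⇒≥ a≯x+2)))

removeBlock⇒+ : ∀ {k x z} → removeBlock k x z → ∃ λ a → + a ≡ z
removeBlock⇒+ ((+≤+ _ , _) , _) = _ , refl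

restrictedSumset⇔Sums : ∀ h k x z → restrictedSumset h (removeBlock k x) z ⇔ (∃ λ a → Sums h (Block k x) a × z ≡ + a)
restrictedSumset⇔Sums h k x z = mk⇔ to from
  where
  to : restrictedSumset h (removeBlock k x) z → ∃ λ a → Sums h (Block k x) a × z ≡ + a
  to (S , S-unique , S⊆A , refl , refl) with All⇒∃-map (All.map removeBlock⇒+ S⊆A)
  ... | R , refl = sum R ,
    subst (λ n → Sums n (Block k x) (sum R)) (sym (length-map +_ R))
      (sums-fromUnique (Unique.map⁻ S-unique) (All.map removeBlock⇒Block (AllP.map⁻ S⊆A))) ,
    sumℤ-map-+ R
  from : (∃ λ a → Sums h (Block k x) a × z ≡ + a) → restrictedSumset h (removeBlock k x) z
  from (_ , (S , S-dec , S⊆B , refl , refl) , refl) =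
    map +_ S , Unique.map⁺ ℤP.+-injective (Decreasing⇒Unique S-dec) , AllP.map⁺ (All.map Block⇒removeBlock S⊆B) ,
    length-map +_ S , sumℤ-map-+ S

hasCard-fromℕ : ∀ {h k x n} → HasCardℕ (Sums h (Block k x)) n → HasCard (restrictedSumset h (removeBlock k x)) n
hasCard-fromℕ {h} {k} {x} (L , L-enum , |L|≡n) =
  map +_ L , proj₁ image , proj₂ image , trans (cong +_ (length-map +_ L)) |L|≡n
  where
  image : IsEnumeration (map +_ L) (restrictedSumset h (removeBlock k x))
  image = enum-resp (enum-map (λ _ _ → ℤP.+-injective) L-enum) (λ z → ⇔-sym (restrictedSumset⇔Sums h k x z))

hasCard-sym : ∀ {h k x y n} → HasCardℕ (Sums h (Block k y)) n → x ≤ k → x ≡ y ⊎ k ∸ x ≡ y →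
              HasCard (restrictedSumset h (removeBlock k x)) n
hasCard-sym card _   (inj₁ refl) = hasCard-fromℕ card
hasCard-sym card x≤k (inj₂ refl) = hasCard-fromℕ (hasCardℕ-reflect x≤k card)

cardFormula : ℕ → ℕ → ℕ → ℤ
cardFormula h k y = (+ h *ℤ + k) -ℤ (+ h *ℤ + h) +ℤ (+ 3 *ℤ + y) +ℤ + 1

+-≡⇒-ℤ : ∀ {n a b} → n + b ≡ a → + n ≡ + a -ℤ + b
+-≡⇒-ℤ {n} {a} {b} refl = sym (cancel (+ n) (+ b))
  where
  cancel : ∀ N B → N +ℤ B -ℤ B ≡ N
  cancel = ZS.solve-∀

-- Moving summands across the removed block

u+3≤u*[q∸u] : ∀ {u h q} → 1 ≤ u → u < h → 3 ≤ h → h + 2 ≤ q → u + 3 ≤ u * (q ∸ u)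
u+3≤u*[q∸u] {suc zero}    {h} {q} _ _   3≤h h+2≤q =
  ≤-trans (m+n≤o⇒m≤o∸n 4 (≤-trans (+-monoˡ-≤ 2 3≤h) h+2≤q)) (≤-reflexive (sym (+-identityʳ (q ∸ 1))))
u+3≤u*[q∸u] {suc (suc w)} {h} {q} _ u<h _   h+2≤q = begin
  u + 3                ≤⟨ m≤m+n (u + 3) (suc (2 * w)) ⟩
  u + 3 + suc (2 * w)  ≡⟨ triple w ⟩
  u * 3                ≤⟨ *-monoʳ-≤ u (m+n≤o⇒m≤o∸n 3 3+u≤q) ⟩
  u * (q ∸ u)          ∎
  where
  open ≤-Reasoning
  u = suc (suc w)
  3+u≤q : 3 + u ≤ q
  3+u≤q = ≤-trans (≤-reflexive (trans (+-comm 3 u) (+-suc u 2))) (≤-trans (+-monoˡ-≤ 2 u<h) h+2≤q)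
  triple : ∀ w → suc (suc w) + 3 + suc (2 * w) ≡ suc (suc w) * 3
  triple = solve-∀

low-high-identity : ∀ {x} u v e tu tv w → x ≡ suc v + e →
  (3 + x) * suc u + (tu + u) + tv + (v * e + u * w) ≡ suc ((3 + x) * u + tu + u * w + ((tv + v) + suc v * e)) + (u + 3)
low-high-identity u v e tu tv w refl = identity u v e tu tv w
  where
  identity : ∀ u v e tu tv w →
    (3 + (suc v + e)) * suc u + (tu + u) + tv + (v * e + u * w) ≡
    suc ((3 + (suc v + e)) * u + tu + u * w + ((tv + v) + suc v * e)) + (u + 3)
  identity = solve-∀

-- low v and high v are the least and the greatest sum of v summands below x and h ∸ v above x + 2.
module Splits (h k x : ℕ) (3≤h : 3 ≤ h) (x≤k : x ≤ k) (h+2≤q : h + 2 ≤ k ∸ x) where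

  q : ℕ
  q = k ∸ x

  h≤q : h ≤ q
  h≤q = ≤-trans (m≤m+n h 2) h+2≤q

  Sumsᴬ : ℕ → Set
  Sumsᴬ = Sums h (Block k x)

  low high : ℕ → ℕ
  low  v = (3 + x) * (h ∸ v) + tri (h ∸ v) + tri v
  high v = (3 + x) * (h ∸ v) + tri (h ∸ v) + (h ∸ v) * (q ∸ (h ∸ v)) + (tri v + v * (x ∸ v))

  top : ℕ
  top = high 0

  covers-split : ∀ {v} → v ≤ h → v ≤ x → Covers Sumsᴬ (low v) (high v)
  covers-split {v} v≤h v≤x = covers-+ join (m≤m+n _ _) (m≤m+n _ _) high-part low-part
    where
    u = h ∸ v
    end : 3 + x + u + (q ∸ u) ≡ suc (k + 2)
    end = begin
      3 + x + u + (q ∸ u)    ≡⟨ +-assoc (3 + x) u (q ∸ u) ⟩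
      3 + x + (u + (q ∸ u))  ≡⟨ cong (λ n → 3 + x + n) (m+[n∸m]≡n (≤-trans (m∸n≤m h v) h≤q)) ⟩
      3 + (x + q)            ≡⟨ cong (λ n → 3 + n) (m+[n∸m]≡n x≤k) ⟩
      3 + k                  ≡⟨ cong suc (+-comm 2 k) ⟩
      suc (k + 2)            ∎
      where open ≡-Reasoning
    Above : ℕ → Set
    Above = Ico (3 + x) (3 + x + u + (q ∸ u))
    Below : ℕ → Set
    Below = Ico 0 (v + (x ∸ v))
    high-part : Covers (Sums u Above) ((3 + x) * u + tri u) ((3 + x) * u + tri u + u * (q ∸ u))
    high-part = covers-offsets (interval-sums u (3 + x) (q ∸ u))
    low-part : Covers (Sums v Below) (tri v) (tri v + v * (x ∸ v))
    low-part = covers-offsets (interval-sums v 0 (x ∸ v))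
    below<x : ∀ {c} → Below c → c < x
    below<x (_ , c<end) = ≤-trans c<end (≤-reflexive (m+[n∸m]≡n v≤x))
    Above⊆Block : ∀ {b} → Above b → Block k x b
    Above⊆Block (3+x≤b , b<end) =
      ≤-pred (≤-trans b<end (≤-reflexive end)) , inj₂ (≤-trans (≤-reflexive (cong suc (+-comm x 2))) 3+x≤b)
    Below⊆Block : ∀ {c} → Below c → Block k x c
    Below⊆Block c∈ = <⇒≤ (≤-trans (below<x c∈) (≤-trans x≤k (m≤m+n k 2))) , inj₁ (below<x c∈)
    below<above : ∀ {b c} → Above b → Below c → c < b
    below<above (3+x≤b , _) c∈ = ≤-trans (below<x c∈) (≤-trans (m≤n+m x 3) 3+x≤b)
    join : ∀ {m n} → Sums u Above m → Sums v Below n → Sumsᴬ (m + n)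
    join above below = subst (λ n → Sums n (Block k x) _) (m∸n+n≡m v≤h)
      (sums-mono [ Above⊆Block , Below⊆Block ]′ (sums-++ below<above above below))

  sums-low : ∀ {v} → v ≤ h → v ≤ x → Sumsᴬ (low v)
  sums-low {v} v≤h v≤x = covers-split v≤h v≤x _ ≤-refl
    (+-mono-≤ (m≤m+n ((3 + x) * u + tri u) (u * (q ∸ u))) (m≤m+n (tri v) (v * (x ∸ v))))
    where u = h ∸ v

  low-h : low h ≡ tri h
  low-h = begin
    (3 + x) * (h ∸ h) + tri (h ∸ h) + tri h  ≡⟨ cong (λ u → (3 + x) * u + tri u + tri h) (n∸n≡0 h) ⟩
    (3 + x) * 0 + 0 + tri h                  ≡⟨ cong (λ z → z + 0 + tri h) (*-zeroʳ (3 + x)) ⟩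
    tri h                                    ∎
    where open ≡-Reasoning

  low-x : x ≤ h → low x ≡ tri h + 3 * (h ∸ x)
  low-x x≤h = begin
    (3 + x) * d + tri d + tri x    ≡⟨ regroup x d (tri x) (tri d) ⟩
    tri x + tri d + x * d + 3 * d  ≡⟨ cong (_+ 3 * d) (sym (tri-+ x d)) ⟩
    tri (x + d) + 3 * d            ≡⟨ cong (λ n → tri n + 3 * d) (m+[n∸m]≡n x≤h) ⟩
    tri h + 3 * d                  ∎
    where
    open ≡-Reasoning
    d = h ∸ x
    regroup : ∀ x d s t → (3 + x) * d + t + s ≡ s + t + x * d + 3 * d
    regroup = solve-∀

  low≤suc-high : ∀ {v} → suc v ≤ h → suc v ≤ x →
                 (h ∸ suc v) + 3 ≤ v * (x ∸ suc v) + (h ∸ suc v) * (q ∸ (h ∸ suc v)) →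
                 low v ≤ suc (high (suc v))
  low≤suc-high {v} sv≤h sv≤x room = +-cancelʳ-≤ (u + 3) (low v) (suc (high (suc v))) (begin
    low v + (u + 3)
      ≤⟨ +-monoʳ-≤ (low v) room ⟩
    low v + (v * e + u * (q ∸ u))
      ≡⟨ cong (λ w → (3 + x) * w + tri w + tri v + (v * e + u * (q ∸ u))) h∸v≡1+u ⟩
    (3 + x) * suc u + tri (suc u) + tri v + (v * e + u * (q ∸ u))
      ≡⟨ low-high-identity u v e (tri u) (tri v) (q ∸ u) (sym (m+[n∸m]≡n sv≤x)) ⟩
    suc (high (suc v)) + (u + 3)
      ∎)
    where
    open ≤-Reasoning
    u = h ∸ suc v
    e = x ∸ suc v
    h∸v≡1+u : h ∸ v ≡ suc u
    h∸v≡1+u = +-∸-assoc 1 sv≤h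

  covers-chain : ∀ v → v < h → v ≤ x → Covers Sumsᴬ (low v) top
  covers-chain zero    _    _    = covers-split z≤n z≤n
  covers-chain (suc v) sv<h sv≤x =
    covers-∪ (covers-split (<⇒≤ sv<h) sv≤x)
             (covers-chain v (<-trans (n<1+n v) sv<h) (<⇒≤ sv≤x))
             (low≤suc-high (<⇒≤ sv<h) sv≤x (≤-trans (u+3≤u*[q∸u] 1≤u u<h 3≤h h+2≤q) (m≤n+m _ _)))
    where
    1≤u : 1 ≤ h ∸ suc v
    1≤u = m+n≤o⇒m≤o∸n 1 sv<h
    u<h : h ∸ suc v < h
    u<h = ∸-monoʳ-< z<s (<⇒≤ sv<h)

  covers-full : ∀ v → suc v ≡ h → suc v ≤ x → 3 ≤ v * (x ∸ suc v) → Covers Sumsᴬ (low (suc v)) top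
  covers-full v refl sv≤x 3≤v*e =
    covers-∪ (covers-split ≤-refl sv≤x)
             (covers-chain v (n<1+n v) (<⇒≤ sv≤x))
             (low≤suc-high ≤-refl sv≤x (subst (λ u → u + 3 ≤ v * (x ∸ suc v) + u * (q ∸ u)) (sym (n∸n≡0 h))
                                               (≤-trans 3≤v*e (m≤m+n _ _))))

  top-eq : top + tri h + h ≡ h * (k + 3)
  top-eq = begin
    top + tri h + h                                  ≡⟨ regroup (3 + x) h (tri h) (q ∸ h) ⟩
    (3 + x) * h + h * (q ∸ h) + (tri h + tri h + h)  ≡⟨ cong (λ n → (3 + x) * h + h * (q ∸ h) + n) (tri-double h) ⟩
    (3 + x) * h + h * (q ∸ h) + h * h                ≡⟨ factor x h (q ∸ h) ⟩
    h * (3 + x + (q ∸ h + h))                        ≡⟨ cong (λ n → h * (3 + x + n)) (m∸n+n≡m h≤q) ⟩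
    h * (3 + (x + q))                                ≡⟨ cong (λ n → h * (3 + n)) (m+[n∸m]≡n x≤k) ⟩
    h * (3 + k)                                      ≡⟨ cong (h *_) (+-comm 3 k) ⟩
    h * (k + 3)                                      ∎
    where
    open ≡-Reasoning
    regroup : ∀ a h t d → a * h + t + h * d + 0 + t + h ≡ a * h + h * d + (t + t + h)
    regroup = solve-∀
    factor : ∀ x h d → (3 + x) * h + h * d + h * h ≡ h * (3 + x + (d + h))
    factor = solve-∀

  sums-≤-top : ∀ {m} → Sumsᴬ m → m ≤ top
  sums-≤-top {m} sums = +-cancelʳ-≤ (tri h + h) m top (begin
    m + (tri h + h)    ≡⟨ sym (+-assoc m (tri h) h) ⟩
    m + tri h + h      ≤⟨ sums-≤ Block⇒< sums ⟩
    h * (k + 3)        ≡⟨ sym top-eq ⟩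
    top + tri h + h    ≡⟨ +-assoc top (tri h) h ⟩
    top + (tri h + h)  ∎)
    where open ≤-Reasoning

  tri+c≤top : ∀ {c} → c ≤ 3 * h → tri h + c ≤ top
  tri+c≤top {c} c≤3h = begin
    tri h + c                              ≤⟨ +-monoʳ-≤ (tri h) c≤3h ⟩
    tri h + 3 * h                          ≤⟨ m≤m+n (tri h + 3 * h) (x * h + h * (q ∸ h)) ⟩
    tri h + 3 * h + (x * h + h * (q ∸ h))  ≡⟨ regroup x h (tri h) (q ∸ h) ⟩
    top                                    ∎
    where
    open ≤-Reasoning
    regroup : ∀ x h t d → t + 3 * h + (x * h + h * d) ≡ (3 + x) * h + t + h * d + 0
    regroup = solve-∀

  size-above : ∀ c → c ≤ 3 * h → + (suc top ∸ (tri h + c)) ≡ cardFormula h k h -ℤ + c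
  size-above c c≤3h = begin
    + n                                                ≡⟨ +-≡⇒-ℤ count ⟩
    + (h * (k + 3) + 1) -ℤ + (c + h * h)
      ≡⟨ cong₂ (λ a b → a +ℤ + 1 -ℤ (+ c +ℤ b)) (ℤP.pos-* h (k + 3)) (ℤP.pos-* h h) ⟩
    + h *ℤ (+ k +ℤ + 3) +ℤ + 1 -ℤ (+ c +ℤ + h *ℤ + h)  ≡⟨ expand (+ h) (+ k) (+ c) ⟩
    cardFormula h k h -ℤ + c                           ∎
    where
    open ≡-Reasoning
    n = suc top ∸ (tri h + c)
    count : n + (c + h * h) ≡ h * (k + 3) + 1
    count = begin
      n + (c + h * h)                ≡⟨ cong (λ s → n + (c + s)) (sym (tri-double h)) ⟩
      n + (c + (tri h + tri h + h))  ≡⟨ regroup n c (tri h) h ⟩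
      n + (tri h + c) + tri h + h    ≡⟨ cong (λ s → s + tri h + h) (m∸n+n≡m (m≤n⇒m≤1+n (tri+c≤top c≤3h))) ⟩
      suc (top + tri h + h)          ≡⟨ cong suc top-eq ⟩
      suc (h * (k + 3))              ≡⟨ +-comm 1 (h * (k + 3)) ⟩
      h * (k + 3) + 1                ∎
      where
      regroup : ∀ n c t h → n + (c + (t + t + h)) ≡ n + (t + c) + t + h
      regroup = solve-∀
    expand : ∀ H K C → H *ℤ (K +ℤ + 3) +ℤ + 1 -ℤ (C +ℤ H *ℤ H) ≡
                       (H *ℤ K) -ℤ (H *ℤ H) +ℤ (+ 3 *ℤ H) +ℤ + 1 -ℤ C
    expand = ZS.solve-∀

  hasCard-above : ∀ c → c ≤ 3 * h → HasCardℕ (λ m → tri h + c ≤ m × m ≤ top) (cardFormula h k h -ℤ + c)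
  hasCard-above c c≤3h =
    subst (HasCardℕ _) (size-above c c≤3h) (hasCardℕ-Icc (tri h + c) top (m≤n⇒m≤1+n (tri+c≤top c≤3h)))

-- The five cases

cardℕ-x<h : ∀ {h k x} → 3 ≤ h → x < h → x ≤ k → h + 2 ≤ k ∸ x →
             HasCardℕ (Sums h (Block k x)) (cardFormula h k x)
cardℕ-x<h {h} {k} {x} 3≤h x<h x≤k h+2≤q =
  subst (HasCardℕ _) formula
    (hasCardℕ-resp (hasCard-above (3 * (h ∸ x)) (*-monoʳ-≤ 3 (m∸n≤m h x))) λ m → mk⇔ covered bounded)
  where
  open Splits h k x 3≤h x≤k h+2≤q
  covered : ∀ {m} → tri h + 3 * (h ∸ x) ≤ m × m ≤ top → Sumsᴬ m
  covered (lo , hi) = covers-chain x x<h ≤-refl _ (≤-trans (≤-reflexive (low-x (<⇒≤ x<h))) lo) hi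
  bounded : ∀ {m} → Sumsᴬ m → tri h + 3 * (h ∸ x) ≤ m × m ≤ top
  bounded sums = sums-Block-≥ sums , sums-≤-top sums
  formula : cardFormula h k h -ℤ + (3 * (h ∸ x)) ≡ cardFormula h k x
  formula = begin
    cardFormula h k h -ℤ + (3 * (h ∸ x))      ≡⟨ cong (cardFormula h k h -ℤ_) (ℤP.pos-* 3 (h ∸ x)) ⟩
    cardFormula h k h -ℤ + 3 *ℤ + (h ∸ x)
      ≡⟨ cong (λ d → cardFormula h k h -ℤ + 3 *ℤ d) (+-≡⇒-ℤ {h ∸ x} (m∸n+n≡m (<⇒≤ x<h))) ⟩
    cardFormula h k h -ℤ + 3 *ℤ (+ h -ℤ + x)  ≡⟨ simplify (+ h) (+ k) (+ x) ⟩
    cardFormula h k x                         ∎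
    where
    open ≡-Reasoning
    simplify : ∀ H K X → (H *ℤ K) -ℤ (H *ℤ H) +ℤ (+ 3 *ℤ H) +ℤ + 1 -ℤ + 3 *ℤ (H -ℤ X) ≡
                         (H *ℤ K) -ℤ (H *ℤ H) +ℤ (+ 3 *ℤ X) +ℤ + 1
    simplify = ZS.solve-∀

cardℕ-x>h : ∀ {h k x} → 3 ≤ h → h < x → x ≤ k → h + 2 ≤ k ∸ x → 3 ≤ (h ∸ 1) * (x ∸ h) →
            HasCardℕ (Sums h (Block k x)) (cardFormula h k h)
cardℕ-x>h {suc v} {k} {x} 3≤h h<x x≤k h+2≤q room =
  subst (HasCardℕ _) (ℤP.+-identityʳ _) (hasCardℕ-resp (hasCard-above 0 z≤n) λ m → mk⇔ covered bounded)
  where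
  open Splits (suc v) k x 3≤h x≤k h+2≤q
  covered : ∀ {m} → tri (suc v) + 0 ≤ m × m ≤ top → Sumsᴬ m
  covered (lo , hi) = covers-full v refl (<⇒≤ h<x) room _ (≤-trans (≤-reflexive (trans low-h (sym (+-identityʳ _)))) lo) hi
  bounded : ∀ {m} → Sumsᴬ m → tri (suc v) + 0 ≤ m × m ≤ top
  bounded sums = ≤-trans (+-monoʳ-≤ (tri (suc v)) z≤n) (sums-Block-≥ sums) , sums-≤-top sums

cardℕ-x≡h : ∀ {h k} → 3 ≤ h → h ≤ k → h + 2 ≤ k ∸ h →
            HasCardℕ (Sums h (Block k h)) ((+ h *ℤ + k) -ℤ (+ h *ℤ + h) +ℤ (+ 3 *ℤ + h) -ℤ + 2)
cardℕ-x≡h {suc v} {k} 3≤h h≤k h+2≤q =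
  subst (HasCardℕ _) formula
    (hasCardℕ-resp (hasCardℕ-⊎ (hasCardℕ-Icc (tri h) (tri h) (n≤1+n _)) (hasCard-above 4 4≤3h) disjoint)
      λ m → mk⇔ covered bounded)
  where
  h = suc v
  open Splits h k h 3≤h h≤k h+2≤q
  4≤3h : 4 ≤ 3 * h
  4≤3h = ≤-trans (s≤s (s≤s (s≤s (s≤s z≤n)))) (*-monoʳ-≤ 3 3≤h)
  low-v : low v ≡ tri h + 4
  low-v = trans (cong (λ u → (3 + h) * u + tri u + tri v) (m+n∸n≡m 1 v)) (regroup v (tri v))
    where
    regroup : ∀ v t → (3 + suc v) * 1 + 0 + t ≡ t + v + 4
    regroup = solve-∀
  disjoint : ∀ {m} → tri h ≤ m × m ≤ tri h → tri h + 4 ≤ m × m ≤ top → ⊥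
  disjoint (_ , m≤t) (t+4≤m , _) = <⇒≱ (<-≤-trans (m<m+n (tri h) z<s) t+4≤m) m≤t
  covered : ∀ {m} → (tri h ≤ m × m ≤ tri h) ⊎ (tri h + 4 ≤ m × m ≤ top) → Sumsᴬ m
  covered (inj₁ (t≤m , m≤t)) =
    subst Sumsᴬ (trans low-h (≤-antisym t≤m m≤t)) (sums-low ≤-refl ≤-refl)
  covered (inj₂ (lo , hi))   = covers-chain v (n<1+n v) (n≤1+n v) _ (≤-trans (≤-reflexive low-v) lo) hi
  bounded : ∀ {m} → Sumsᴬ m → (tri h ≤ m × m ≤ tri h) ⊎ (tri h + 4 ≤ m × m ≤ top)
  bounded {m} sums with sums-Block-gap sums
  ... | inj₁ small = inj₁ (≤-trans (m≤m+n (tri h) _) (sums-Block-≥ sums) , +-cancelʳ-≤ (tri h + h) m (tri h) (begin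
    m + (tri h + h)      ≡⟨ sym (+-assoc m (tri h) h) ⟩
    m + tri h + h        ≤⟨ small ⟩
    h * h                ≡⟨ sym (tri-double h) ⟩
    tri h + tri h + h    ≡⟨ +-assoc (tri h) (tri h) h ⟩
    tri h + (tri h + h)  ∎))
    where open ≤-Reasoning
  ... | inj₂ big   = inj₂ (≤-trans (≤-reflexive (regroup v (tri v))) big , sums-≤-top sums)
    where
    regroup : ∀ v t → t + v + 4 ≡ suc v + 3 + t
    regroup = solve-∀
  formula : + (suc (tri h) ∸ tri h) +ℤ (cardFormula h k h -ℤ + 4) ≡ (+ h *ℤ + k) -ℤ (+ h *ℤ + h) +ℤ (+ 3 *ℤ + h) -ℤ + 2
  formula = trans (cong (λ n → + n +ℤ (cardFormula h k h -ℤ + 4)) (m+n∸n≡m 1 (tri h))) (simplify (+ h) (+ k))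
    where
    simplify : ∀ H K → + 1 +ℤ ((H *ℤ K) -ℤ (H *ℤ H) +ℤ (+ 3 *ℤ H) +ℤ + 1 -ℤ + 4) ≡
                       (H *ℤ K) -ℤ (H *ℤ H) +ℤ (+ 3 *ℤ H) -ℤ + 2
    simplify = ZS.solve-∀

-- Here the first move across the block fails, as (h − 1)(x − h) = 2 < 3: the sum 7 is missing.
cardℕ-h≡3-x≡4 : ∀ {k} → 13 ≤ k → HasCardℕ (Sums 3 (Block k 4)) (+ (3 * k))
cardℕ-h≡3-x≡4 {k} 13≤k =
  subst (HasCardℕ _) formula
    (hasCardℕ-resp (hasCardℕ-⊎ (hasCardℕ-Icc 3 6 (s≤s (s≤s (s≤s z≤n)))) (hasCard-above 5 5≤9) disjoint)
      λ m → mk⇔ covered bounded)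
  where
  4≤k : 4 ≤ k
  4≤k = ≤-trans (s≤s (s≤s (s≤s (s≤s z≤n)))) 13≤k
  5≤k∸4 : 5 ≤ k ∸ 4
  5≤k∸4 = m+n≤o⇒m≤o∸n 5 (≤-trans (s≤s (s≤s (s≤s (s≤s (s≤s (s≤s (s≤s (s≤s (s≤s z≤n))))))))) 13≤k)
  open Splits 3 k 4 ≤-refl 4≤k 5≤k∸4
  5≤9 : 5 ≤ 9
  5≤9 = s≤s (s≤s (s≤s (s≤s (s≤s z≤n))))
  disjoint : ∀ {m} → 3 ≤ m × m ≤ 6 → 8 ≤ m × m ≤ top → ⊥
  disjoint (_ , m≤6) (8≤m , _) = <⇒≱ (≤-trans (s≤s (s≤s (s≤s (s≤s (s≤s (s≤s (s≤s z≤n))))))) 8≤m) m≤6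
  covered : ∀ {m} → (3 ≤ m × m ≤ 6) ⊎ (8 ≤ m × m ≤ top) → Sumsᴬ m
  covered (inj₁ (lo , hi)) = covers-split {3} ≤-refl (s≤s (s≤s (s≤s z≤n))) _ lo hi
  covered (inj₂ (lo , hi)) = covers-chain 2 (s≤s (s≤s (s≤s z≤n))) (s≤s (s≤s z≤n)) _ lo hi
  bounded : ∀ {m} → Sumsᴬ m → (3 ≤ m × m ≤ 6) ⊎ (8 ≤ m × m ≤ top)
  bounded {m} sums with sums-Block-gap sums
  ... | inj₁ small = inj₁ (sums-Block-≥ sums , +-cancelʳ-≤ 6 m 6 (≤-trans (≤-reflexive (sym (+-assoc m 3 3))) small))
  ... | inj₂ big   = inj₂ (big , sums-≤-top sums)
  formula : + 4 +ℤ (cardFormula 3 k 3 -ℤ + 5) ≡ + (3 * k)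
  formula = trans (simplify (+ k)) (sym (ℤP.pos-* 3 k))
    where
    simplify : ∀ K → + 4 +ℤ ((+ 3 *ℤ K) -ℤ (+ 3 *ℤ + 3) +ℤ (+ 3 *ℤ + 3) +ℤ + 1 -ℤ + 5) ≡ + 3 *ℤ K
    simplify = ZS.solve-∀

h+c≤k : ∀ h {k c} → c ≤ 4 → 3 * h + 4 ≤ k → h + c ≤ k
h+c≤k h c≤4 3h+4≤k = ≤-trans (+-mono-≤ (m≤n*m h 3) c≤4) 3h+4≤k

h≤k : ∀ h {k} → 3 * h + 4 ≤ k → h ≤ k
h≤k h 3h+4≤k = ≤-trans (m≤m+n h 0) (h+c≤k h z≤n 3h+4≤k)

h+2≤k∸y : ∀ h {k y} → 3 * h + 4 ≤ k → y ≤ h + 2 → h + 2 ≤ k ∸ y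
h+2≤k∸y h {k} {y} 3h+4≤k y≤h+2 = m+n≤o⇒m≤o∸n (h + 2) (begin
  h + 2 + y              ≤⟨ +-monoʳ-≤ (h + 2) y≤h+2 ⟩
  h + 2 + (h + 2)        ≤⟨ m≤m+n (h + 2 + (h + 2)) h ⟩
  h + 2 + (h + 2) + h    ≡⟨ regroup h ⟩
  3 * h + 4              ≤⟨ 3h+4≤k ⟩
  k                      ∎)
  where
  open ≤-Reasoning
  regroup : ∀ h → h + 2 + (h + 2) + h ≡ 3 * h + 4
  regroup = solve-∀

mirror : ∀ {k x y} → y ≤ k → x ≡ k ∸ y → k ∸ x ≡ y
mirror y≤k refl = m∸[m∸n]≡n y≤k

card-x<h : ∀ {h k x} → 3 ≤ h → 3 * h + 4 ≤ k → x ≤ k → x ≤ h ∸ 1 →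
           HasCard (restrictedSumset h (removeBlock k x)) (cardFormula h k x)
card-x<h {suc h′} 3≤h 3h+4≤k x≤k x≤h′ =
  hasCard-fromℕ (cardℕ-x<h 3≤h (s≤s x≤h′) x≤k
    (h+2≤k∸y (suc h′) 3h+4≤k (≤-trans (m≤n⇒m≤1+n x≤h′) (m≤m+n _ 2))))

card-x>k∸h : ∀ {h k x} → 3 ≤ h → 3 * h + 4 ≤ k → x ≤ k → k ∸ h + 1 ≤ x →
             HasCard (restrictedSumset h (removeBlock k x)) ((+ (h + 3) *ℤ + k) -ℤ (+ h *ℤ + h) -ℤ (+ 3 *ℤ + x) +ℤ + 1)
card-x>k∸h {h} {k} {x} 3≤h 3h+4≤k x≤k k∸h+1≤x =
  hasCard-fromℕ (hasCardℕ-reflect x≤k (subst (HasCardℕ _) formula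
    (cardℕ-x<h 3≤h y<h (m∸n≤m k x) (subst (h + 2 ≤_) (sym (m∸[m∸n]≡n x≤k)) h+2≤x))))
  where
  h+2≤x : h + 2 ≤ x
  h+2≤x = ≤-trans (h+2≤k∸y h 3h+4≤k (m≤m+n h 2)) (≤-trans (m≤m+n (k ∸ h) 1) k∸h+1≤x)
  y<h : k ∸ x < h
  y<h = +-cancelʳ-≤ x (suc (k ∸ x)) h (begin
    suc (k ∸ x) + x  ≡⟨ cong suc (m∸n+n≡m x≤k) ⟩
    suc k            ≡⟨ cong suc (sym (m∸n+n≡m (h≤k h 3h+4≤k))) ⟩
    suc (k ∸ h + h)  ≡⟨ regroup (k ∸ h) h ⟩
    k ∸ h + 1 + h    ≤⟨ +-monoˡ-≤ h k∸h+1≤x ⟩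
    x + h            ≡⟨ +-comm x h ⟩
    h + x            ∎)
    where
    open ≤-Reasoning
    regroup : ∀ d h → suc (d + h) ≡ d + 1 + h
    regroup = solve-∀
  formula : cardFormula h k (k ∸ x) ≡ (+ (h + 3) *ℤ + k) -ℤ (+ h *ℤ + h) -ℤ (+ 3 *ℤ + x) +ℤ + 1
  formula = trans (cong (λ y → (+ h *ℤ + k) -ℤ (+ h *ℤ + h) +ℤ (+ 3 *ℤ y) +ℤ + 1) (+-≡⇒-ℤ {k ∸ x} (m∸n+n≡m x≤k)))
                  (simplify (+ h) (+ k) (+ x))
    where
    simplify : ∀ H K X → (H *ℤ K) -ℤ (H *ℤ H) +ℤ (+ 3 *ℤ (K -ℤ X)) +ℤ + 1 ≡
                         ((H +ℤ + 3) *ℤ K) -ℤ (H *ℤ H) -ℤ (+ 3 *ℤ X) +ℤ + 1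
    simplify = ZS.solve-∀

card-x≡h : ∀ {h k x} → 3 ≤ h → 3 * h + 4 ≤ k → x ≤ k → x ≡ h ⊎ x ≡ k ∸ h →
           HasCard (restrictedSumset h (removeBlock k x)) ((+ h *ℤ + k) -ℤ (+ h *ℤ + h) +ℤ (+ 3 *ℤ + h) -ℤ + 2)
card-x≡h {h} 3≤h 3h+4≤k x≤k x≡h⊎k∸h =
  hasCard-sym (cardℕ-x≡h 3≤h (h≤k h 3h+4≤k) (h+2≤k∸y h 3h+4≤k (m≤m+n h 2))) x≤k
    (Sum.map₂ (mirror (h≤k h 3h+4≤k)) x≡h⊎k∸h)

card-x≡h+1 : ∀ {h k x} → 3 ≤ h → 3 * h + 4 ≤ k → x ≤ k → x ≡ h + 1 ⊎ x ≡ k ∸ h ∸ 1 →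
             (h ≡ 3 → HasCard (restrictedSumset h (removeBlock k x)) (+ (3 * k)))
             × (4 ≤ h → HasCard (restrictedSumset h (removeBlock k x)) (cardFormula h k h))
card-x≡h+1 {h} {k} {x} 3≤h 3h+4≤k x≤k x≡h+1⊎k∸h∸1 = h≡3-case , 4≤h-case
  where
  h+1≤k : h + 1 ≤ k
  h+1≤k = h+c≤k h (s≤s z≤n) 3h+4≤k
  x≡h+1⊎k∸x≡h+1 : x ≡ h + 1 ⊎ k ∸ x ≡ h + 1
  x≡h+1⊎k∸x≡h+1 = Sum.map₂ (λ x≡ → mirror h+1≤k (trans x≡ (∸-+-assoc k h 1))) x≡h+1⊎k∸h∸1
  h≡3-case : h ≡ 3 → HasCard (restrictedSumset h (removeBlock k x)) (+ (3 * k))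
  h≡3-case refl = hasCard-sym (cardℕ-h≡3-x≡4 3h+4≤k) x≤k x≡h+1⊎k∸x≡h+1
  4≤h-case : 4 ≤ h → HasCard (restrictedSumset h (removeBlock k x)) (cardFormula h k h)
  4≤h-case 4≤h = hasCard-sym (cardℕ-x>h 3≤h (m<m+n h z<s) h+1≤k (h+2≤k∸y h 3h+4≤k (+-monoʳ-≤ h (s≤s z≤n))) room)
                   x≤k x≡h+1⊎k∸x≡h+1
    where
    room : 3 ≤ (h ∸ 1) * (h + 1 ∸ h)
    room = subst (3 ≤_) (sym (trans (cong ((h ∸ 1) *_) (m+n∸m≡n h 1)) (*-identityʳ (h ∸ 1)))) (∸-monoˡ-≤ 1 4≤h)

card-middle : ∀ {h k x} → 3 ≤ h → 3 * h + 4 ≤ k → h + 2 ≤ x → x ≤ k ∸ h ∸ 2 →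
              HasCard (restrictedSumset h (removeBlock k x)) (cardFormula h k h)
card-middle {h} {k} {x} 3≤h 3h+4≤k h+2≤x x≤k∸h∸2 =
  hasCard-fromℕ (cardℕ-x>h 3≤h (<-≤-trans (m<m+n h z<s) h+2≤x) x≤k h+2≤k∸x room)
  where
  x+[h+2]≤k : x + (h + 2) ≤ k
  x+[h+2]≤k = m≤o∸n⇒m+n≤o x (h+c≤k h (s≤s (s≤s z≤n)) 3h+4≤k) (subst (x ≤_) (∸-+-assoc k h 2) x≤k∸h∸2)
  x≤k : x ≤ k
  x≤k = ≤-trans (m≤m+n x (h + 2)) x+[h+2]≤k
  h+2≤k∸x : h + 2 ≤ k ∸ x
  h+2≤k∸x = m+n≤o⇒m≤o∸n (h + 2) (subst (_≤ k) (+-comm x (h + 2)) x+[h+2]≤k)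
  room : 3 ≤ (h ∸ 1) * (x ∸ h)
  room = ≤-trans (n≤1+n 3) (*-mono-≤ (∸-monoˡ-≤ 1 3≤h) (m+n≤o⇒m≤o∸n 2 (subst (_≤ x) (+-comm h 2) h+2≤x)))

proposition2p9 : (h k x : ℕ) → 3 ≤ h → 3 * h + 4 ≤ k → 1 ≤ x → x ≤ k ∸ 1 →
    ((1 ≤ x × x ≤ h ∸ 1) →
        HasCard (restrictedSumset h (removeBlock k x))
          ((+ h *ℤ + k) -ℤ (+ h *ℤ + h) +ℤ (+ 3 *ℤ + x) +ℤ + 1))
    × ((k ∸ h + 1 ≤ x × x ≤ k ∸ 1) →
        HasCard (restrictedSumset h (removeBlock k x))
          ((+ (h + 3) *ℤ + k) -ℤ (+ h *ℤ + h) -ℤ (+ 3 *ℤ + x) +ℤ + 1))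
    × ((x ≡ h ⊎ x ≡ k ∸ h) →
        HasCard (restrictedSumset h (removeBlock k x))
          ((+ h *ℤ + k) -ℤ (+ h *ℤ + h) +ℤ (+ 3 *ℤ + h) -ℤ + 2))
    × ((x ≡ h + 1 ⊎ x ≡ k ∸ h ∸ 1) →
        (h ≡ 3 → HasCard (restrictedSumset h (removeBlock k x)) (+ (3 * k)))
        × (4 ≤ h → HasCard (restrictedSumset h (removeBlock k x))
             ((+ h *ℤ + k) -ℤ (+ h *ℤ + h) +ℤ (+ 3 *ℤ + h) +ℤ + 1)))
    × ((h + 2 ≤ x × x ≤ k ∸ h ∸ 2) →
        HasCard (restrictedSumset h (removeBlock k x))
          ((+ h *ℤ + k) -ℤ (+ h *ℤ + h) +ℤ (+ 3 *ℤ + h) +ℤ + 1))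
proposition2p9 h k x 3≤h 3h+4≤k _ x≤k∸1 =
  (λ (_ , x≤h∸1) → card-x<h 3≤h 3h+4≤k x≤k x≤h∸1) ,
  (λ (k∸h+1≤x , _) → card-x>k∸h 3≤h 3h+4≤k x≤k k∸h+1≤x) ,
  card-x≡h 3≤h 3h+4≤k x≤k ,
  card-x≡h+1 3≤h 3h+4≤k x≤k ,
  (λ (h+2≤x , x≤k∸h∸2) → card-middle 3≤h 3h+4≤k h+2≤x x≤k∸h∸2)
  where
  x≤k : x ≤ k
  x≤k = ≤-trans x≤k∸1 (m∸n≤m k 1)
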